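{- Let $D$ be a $k$-minimal digraph of order $n$ which has a balanced acyclic complete coloring with $k$ colors, with chromatic classes $V_i=\{u_{i,1},\dots,u_{i,q}\}$ ($i\in[k]$), so that $qk=n$. Let $m\geq 2$ and for each $i\in[k]$ let $X_i=\{H_{u_{i,1}},\dots,H_{u_{i,q}}\}$ be a relabel factorization of $K_m$ into $q$ factors, all digraphs $H_{u_{i,j}}$ being pairwise vertex-disjoint. Let $X=\bigcup_{i=1}^k X_i$. Then $D[X]$ is $km$-minimal and has a balanced acyclic complete coloring with $km$ colors.
   Context: All digraphs are finite and simple (2-cycles allowed). $K_m$ is the complete symmetric digraph on $m$ vertices. A coloring with $k$ colors is a surjection $V(D)\to[k]$; chromatic classes are the color preimages. Acyclic: every chromatic class induces a subdigraph with no directed cycle. Complete: for every ordered pair $(i,j)$ of distinct colors there is an arc from a vertex colored $i$ to a vertex colored $j$. Balanced: all chromatic classes have the same cardinality. $\mathrm{dac}(D)$ is the largest $k$ for which $D$ has an acyclic complete coloring with $k$ colors; $D$ is $k$-minimal if $\mathrm{dac}(D)=k$ and $\mathrm{dac}(D-f)<k$ for every arc $f$. A relabel factorization of $K_m$ into $q$ factors is a family of $q$ pairwise vertex-disjoint digraphs $H_1,\dots,H_q$, $H_j$ having vertex set $\{v^1_j,\dots,v^m_j\}$, such that for every ordered pair $(a,b)$ of distinct elements of $[m]$ there is exactly one $j$ with $v^a_jv^b_j\in A(H_j)$ and the $H_j$ have no other arcs. Zykov sum: for a family $X=\{H_u:u\in V(D)\}$ of nonempty pairwise vertex-disjoint digraphs,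 $D[X]$ has vertex set $\bigcup_u V(H_u)$ and arcs $\bigcup_u A(H_u)\cup\{ab: a\in V(H_u),b\in V(H_v),uv\in A(D)\}$. -}

module Defs where

open import Data.Nat using (ℕ; zero; suc; _<_; _≤_; _*_)
open import Data.Fin using (Fin; zero; suc; inject₁; fromℕ; remQuot; _≟_)
open import Data.Bool using (Bool; true; false; _∧_; not; if_then_else_)
open import Data.Product using (Σ; ∃; ∃₂; _×_; _,_)
open import Data.List using (length; filter; allFin)
open import Relation.Nullary using (¬_)
open import Relation.Nullary.Decidable using (⌊_⌋)
open import Relation.Binary.PropositionalEquality using (_≡_; _≢_)

Digraph : ℕ → Set
Digraph n = Fin n → Fin n → Bool

Arc : ∀ {n} → Digraph n → Fin n → Fin n → Set
Arc D u v = D u v ≡ true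

-- simple: no loops (2-cycles allowed)
Loopless : ∀ {n} → Digraph n → Set
Loopless D = ∀ v → D v v ≡ false

IsCycle : ∀ {n} → Digraph n → (l : ℕ) → (Fin (suc l) → Fin n) → Set
IsCycle D l w =
  (∀ x y → w x ≡ w y → x ≡ y)
  × (∀ (i : Fin l) → Arc D (w (inject₁ i)) (w (suc i)))
  × Arc D (w (fromℕ l)) (w zero)

Surjective : ∀ {n k} → (Fin n → Fin k) → Set
Surjective c = ∀ i → ∃ λ v → c v ≡ i

Acyclic : ∀ {n k} → Digraph n → (Fin n → Fin k) → Set
Acyclic D c = ∀ l w → IsCycle D l w → ¬ (∀ x → c (w x) ≡ c (w zero))

Complete : ∀ {n k} → Digraph n → (Fin n → Fin k) → Set
Complete D c = ∀ i j → i ≢ j → ∃₂ λ u v → Arc D u v × c u ≡ i × c v ≡ j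

classSize : ∀ {n k} → (Fin n → Fin k) → Fin k → ℕ
classSize {n} c i = length (filter (λ v → c v ≟ i) (allFin n))

Balanced : ∀ {n k} → (Fin n → Fin k) → Set
Balanced c = ∀ i j → classSize c i ≡ classSize c j

HasACC : ∀ {n} → Digraph n → ℕ → Set
HasACC {n} D k = Σ (Fin n → Fin k) λ c → Surjective c × Acyclic D c × Complete D c

HasBalancedACC : ∀ {n} → Digraph n → ℕ → Set
HasBalancedACC {n} D k =
  Σ (Fin n → Fin k) λ c → Surjective c × Acyclic D c × Complete D c × Balanced c

IsDac : ∀ {n} → Digraph n → ℕ → Set
IsDac D k = HasACC D k × (∀ k' → HasACC D k' → k' ≤ k)

deleteArc : ∀ {n} → Digraph n → Fin n → Fin n → Digraph n
deleteArc D u v a b = D a b ∧ not (⌊ a ≟ u ⌋ ∧ ⌊ b ≟ v ⌋)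

Minimal : ∀ {n} → Digraph n → ℕ → Set
Minimal D k = IsDac D k × (∀ u v → Arc D u v → ∀ k' → HasACC (deleteArc D u v) k' → k' < k)

-- relabel factorization of K_m into q factors H_j (factor j has vertices v^a_j, a : Fin m)
RelabelFactorization : ∀ {m q} → (Fin q → Digraph m) → Set
RelabelFactorization {m} {q} H =
  (∀ (a b : Fin m) → a ≢ b → ∃ λ j → H j a b ≡ true × (∀ j' → H j' a b ≡ true → j' ≡ j))
  × (∀ j a → H j a a ≡ false)

-- Zykov sum D[X], X = {H_u : u ∈ V(D)}, each H_u having vertex set Fin m;
-- the vertex (u , a) (a-th vertex of H_u) is encoded as an element of Fin (n * m) via remQuot.
zykovAdj : ∀ {n m} → Digraph n → (Fin n → Digraph m) → Fin n × Fin m → Fin n × Fin m → Bool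
zykovAdj D H (u , a) (u' , a') = if ⌊ u ≟ u' ⌋ then H u a a' else D u u'

Zykov : ∀ {n m} → Digraph n → (Fin n → Digraph m) → Digraph (n * m)
Zykov {n} {m} D H p p' = zykovAdj D H (remQuot {n} m p) (remQuot {n} m p')

-- Call a coloring C of G arc-injective if every arc joins two different colors and no two arcs
-- join the same ordered pair of colors. If D is k-minimal, its acyclic complete coloring c is
-- arc-injective, since otherwise some arc could be deleted with c still acyclic and complete.
-- Conversely, an arc-injective acyclic complete coloring with K colors forces minimality: a
-- complete coloring with r colors needs a distinct arc for each of the r(r-1) ordered pairs of
-- distinct colors, while arc-injectivity leaves at most K(K-1) arcs, and fewer once an arc is
-- deleted. On D[X] color the vertex v^a_u by the pair (c u , a). This coloring is acyclic (arcs
-- inside a class come from D), complete, balanced, and arc-injective, because c is and because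
-- each ordered pair (a , b) is an arc of exactly one factor in each color class.
module Submission where

open import Defs
open import Data.Nat using (ℕ; zero; suc; _≤_; _<_; _*_; z≤n; s≤s)
open import Data.Nat.Properties
  using (_≤?_; _<?_; *-mono-<; *-mono-≤; ≰⇒>; ≮⇒≥; <⇒≱; ≤⇒≯; <-irrefl; ≤-antisym)
open import Data.Fin using (Fin; zero; suc; combine; remQuot; punchIn; punchOut; _≟_)
open import Data.Fin.Properties
  using (injective⇒≤; punchOut-injective; punchIn-injective; punchInᵢ≢i; remQuot-combine;
         combine-remQuot; combine-surjective; combine-injective; combine-injectiveˡ; combine-injectiveʳ)
open import Data.Bool using (true; false)
open import Data.Bool.Properties using (∧-zeroʳ; ∧-identityʳ)
open import Data.List using (List; _∷_; length; filter; allFin; lookup)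
open import Data.List.Membership.Propositional using (_∈_)
open import Data.List.Membership.Propositional.Properties using (∈-filter⁺; ∈-filter⁻; ∈-allFin; ∈-lookup)
open import Data.List.Relation.Unary.Any using (index)
open import Data.List.Relation.Unary.Any.Properties using (lookup-index)
import Data.List.Relation.Unary.All as All
open import Data.List.Relation.Unary.AllPairs using (_∷_)
open import Data.List.Relation.Unary.Unique.Propositional using (Unique)
open import Data.List.Relation.Unary.Unique.Propositional.Properties using (filter⁺; allFin⁺)
open import Data.Product using (Σ; ∃; ∃₂; _×_; _,_; proj₁; proj₂)
open import Data.Sum using (_⊎_; inj₁; inj₂)
open import Function using (_∘_)
open import Function.Definitions using (Injective)
open import Relation.Nullary using (¬_; yes; no; contradiction)
open import Relation.Nullary.Decidable using (_×-dec_)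
open import Level using (0ℓ)
open import Relation.Unary using (Pred; Decidable)
open import Relation.Binary.PropositionalEquality

lookup-injective : ∀ {A : Set} {xs : List A} → Unique xs → ∀ i j → lookup xs i ≡ lookup xs j → i ≡ j
lookup-injective (_ ∷ _) zero zero _ = refl
lookup-injective (x∉ ∷ _) zero (suc j) e = contradiction e (All.lookup x∉ (∈-lookup j))
lookup-injective (x∉ ∷ _) (suc i) zero e = contradiction (sym e) (All.lookup x∉ (∈-lookup i))
lookup-injective (_ ∷ u) (suc i) (suc j) e = cong suc (lookup-injective u i j e)

count : ∀ {N} {P : Pred (Fin N) 0ℓ} → Decidable P → ℕ
count {N} P? = length (filter P? (allFin N))

count-≤-injection : ∀ {N N'} {P : Pred (Fin N) 0ℓ} {Q : Pred (Fin N') 0ℓ}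
  (P? : Decidable P) (Q? : Decidable Q) (f : Fin N → Fin N')
  → (∀ x → P x → Q (f x)) → (∀ x y → P x → P y → f x ≡ f y → x ≡ y)
  → count P? ≤ count Q?
count-≤-injection {N} {N'} {P} P? Q? f f-maps f-injective = injective⇒≤ {f = g} g-injective
  where
  xs : List (Fin N)
  xs = filter P? (allFin N)
  ys : List (Fin N')
  ys = filter Q? (allFin N')
  P-lookup : ∀ i → P (lookup xs i)
  P-lookup i = proj₂ (∈-filter⁻ P? {xs = allFin N} (∈-lookup i))
  f-lookup∈ : ∀ i → f (lookup xs i) ∈ ys
  f-lookup∈ i = ∈-filter⁺ Q? (∈-allFin _) (f-maps _ (P-lookup i))
  g : Fin (length xs) → Fin (length ys)
  g i = index (f-lookup∈ i)
  g-injective : Injective _≡_ _≡_ g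
  g-injective {i} {j} e = lookup-injective (filter⁺ P? (allFin⁺ N)) i j
    (f-injective _ _ (P-lookup i) (P-lookup j) (begin
      f (lookup xs i)       ≡⟨ lookup-index (f-lookup∈ i) ⟩
      lookup ys (g i)       ≡⟨ cong (lookup ys) e ⟩
      lookup ys (g j)       ≡⟨ lookup-index (f-lookup∈ j) ⟨
      f (lookup xs j)       ∎))
    where open ≡-Reasoning

injective-avoiding⇒< : ∀ {a M} (g : Fin a → Fin M) → Injective _≡_ _≡_ g
  → (z : Fin M) → (∀ t → g t ≢ z) → a < M
injective-avoiding⇒< {a} {suc M} g g-injective z g≢z = s≤s (injective⇒≤ {f = h} h-injective)
  where
  h : Fin a → Fin M
  h t = punchOut (g≢z t ∘ sym)
  h-injective : Injective _≡_ _≡_ h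
  h-injective {s} {t} e = g-injective (punchOut-injective (g≢z s ∘ sym) (g≢z t ∘ sym) e)

remQuot-injective : ∀ {n} k {s t : Fin (n * k)} → remQuot {n} k s ≡ remQuot {n} k t → s ≡ t
remQuot-injective {n} k {s} {t} e = begin
  s                              ≡⟨ combine-remQuot {n} k s ⟨
  combine (proj₁ (remQuot {n} k s)) (proj₂ (remQuot {n} k s))
                                 ≡⟨ cong (λ p → combine (proj₁ p) (proj₂ p)) e ⟩
  combine (proj₁ (remQuot {n} k t)) (proj₂ (remQuot {n} k t))
                                 ≡⟨ combine-remQuot {n} k t ⟩
  t                              ∎
  where open ≡-Reasoning

pronic-cancel-≤ : ∀ {r K} → suc r * r ≤ suc K * K → r ≤ K
pronic-cancel-≤ {r} {K} h with r ≤? K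
... | yes r≤K = r≤K
... | no r≰K = contradiction h (<⇒≱ (*-mono-< (s≤s (≰⇒> r≰K)) (≰⇒> r≰K)))

pronic-cancel-< : ∀ {r K} → suc r * r < suc K * K → r < K
pronic-cancel-< {r} {K} h with r <? K
... | yes r<K = r<K
... | no r≮K = contradiction h (≤⇒≯ (*-mono-≤ (s≤s (≮⇒≥ r≮K)) (≮⇒≥ r≮K)))

deleteArc-⊆ : ∀ {N} (G : Digraph N) u v {a b} → Arc (deleteArc G u v) a b → Arc G a b
deleteArc-⊆ G u v {a} {b} h with G a b
... | true = refl
... | false = h

deleteArc-deleted : ∀ {N} (G : Digraph N) u v → ¬ Arc (deleteArc G u v) u v
deleteArc-deleted G u v h with u ≟ u | v ≟ v
... | yes _ | yes _ = contradiction (trans (sym h) (∧-zeroʳ (G u v))) λ ()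
... | no u≢u | _ = u≢u refl
... | yes _ | no v≢v = v≢v refl

deleteArc-kept : ∀ {N} (G : Digraph N) u v {a b}
  → Arc G a b → ¬ (a ≡ u × b ≡ v) → Arc (deleteArc G u v) a b
deleteArc-kept G u v {a} {b} h ab≢uv with a ≟ u | b ≟ v
... | yes a≡u | yes b≡v = contradiction (a≡u , b≡v) ab≢uv
... | yes _ | no _ = trans (∧-identityʳ (G a b)) h
... | no _ | _ = trans (∧-identityʳ (G a b)) h

deleteArc-acyclic : ∀ {N K} (G : Digraph N) u v {c : Fin N → Fin K} → Acyclic G c → Acyclic (deleteArc G u v) c
deleteArc-acyclic G u v acyclic l w (w-injective , arcs , closing) =
  acyclic l w (w-injective , deleteArc-⊆ G u v ∘ arcs , deleteArc-⊆ G u v closing)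

-- An injective labelling of the arcs by Fin M, i.e. a witness that G has at most M arcs.
record ArcCoding {N} (G : Digraph N) (M : ℕ) : Set where
  field
    code : ∀ x y → Arc G x y → Fin M
    code-injective : ∀ x y x' y' (a : Arc G x y) (a' : Arc G x' y')
      → code x y a ≡ code x' y' a' → x ≡ x' × y ≡ y'

offDiagonal : ∀ {r} → Fin (suc r * r) → Fin (suc r) × Fin (suc r)
offDiagonal {r} t with i , j ← remQuot {suc r} r t = i , punchIn i j

offDiagonal-distinct : ∀ {r} (t : Fin (suc r * r)) → proj₁ (offDiagonal {r} t) ≢ proj₂ (offDiagonal {r} t)
offDiagonal-distinct {r} t = punchInᵢ≢i (proj₁ (remQuot {suc r} r t)) (proj₂ (remQuot {suc r} r t)) ∘ sym

offDiagonal-injective : ∀ {r} → Injective _≡_ _≡_ (offDiagonal {r})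
offDiagonal-injective {r} {s} {t} e = remQuot-injective {suc r} r (cong₂ _,_ i≡ j≡)
  where
  i≡ : proj₁ (remQuot {suc r} r s) ≡ proj₁ (remQuot {suc r} r t)
  i≡ = cong proj₁ e
  j≡ : proj₂ (remQuot {suc r} r s) ≡ proj₂ (remQuot {suc r} r t)
  j≡ = punchIn-injective (proj₁ (remQuot {suc r} r t)) _ _
    (trans (cong (λ i → punchIn i (proj₂ (remQuot {suc r} r s))) (sym i≡)) (cong proj₂ e))

module _ {N M r} {G : Digraph N} {e : Fin N → Fin (suc r)} (complete : Complete G e) (κ : ArcCoding G M) where
  open ArcCoding κ

  witnessArc : (t : Fin (suc r * r))
    → ∃₂ λ x y → Arc G x y × e x ≡ proj₁ (offDiagonal t) × e y ≡ proj₂ (offDiagonal t)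
  witnessArc t = complete _ _ (offDiagonal-distinct t)

  pairCode : Fin (suc r * r) → Fin M
  pairCode t with x , y , a , _ ← witnessArc t = code x y a

  pairCode-isCode : ∀ t → ∃₂ λ x y → Σ (Arc G x y) λ a → pairCode t ≡ code x y a
  pairCode-isCode t with x , y , a , _ ← witnessArc t = x , y , a , refl

  pairCode-injective : Injective _≡_ _≡_ pairCode
  pairCode-injective {s} {t} eq with witnessArc s | witnessArc t
  ... | x , y , a , ex , ey | x' , y' , a' , ex' , ey'
    with refl , refl ← code-injective x y x' y' a a' eq =
    offDiagonal-injective (cong₂ _,_ (trans (sym ex) ex') (trans (sym ey) ey'))

  complete⇒pronic≤ : suc r * r ≤ M
  complete⇒pronic≤ = injective⇒≤ pairCode-injective

restrictCoding : ∀ {N M} {G : Digraph N} u v → ArcCoding G M → ArcCoding (deleteArc G u v) M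
restrictCoding {G = G} u v κ = record
  { code = λ x y a → code x y (deleteArc-⊆ G u v a)
  ; code-injective = λ x y x' y' a a' → code-injective x y x' y' (deleteArc-⊆ G u v a) (deleteArc-⊆ G u v a')
  }
  where open ArcCoding κ

complete-deleteArc⇒pronic< : ∀ {N M r} {G : Digraph N} {e : Fin N → Fin (suc r)} {u v}
  → Complete (deleteArc G u v) e → ArcCoding G M → Arc G u v → suc r * r < M
complete-deleteArc⇒pronic< {M = M} {G = G} {u = u} {v} complete κ uv =
  injective-avoiding⇒< (pairCode complete κ') (pairCode-injective complete κ') (code u v uv) avoids
  where
  open ArcCoding κ
  κ' : ArcCoding (deleteArc G u v) M
  κ' = restrictCoding u v κ
  avoids : ∀ t → pairCode complete κ' t ≢ code u v uv
  avoids t eq with x , y , a , eq' ← pairCode-isCode complete κ' t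
    with refl , refl ← code-injective x y u v _ uv (trans (sym eq') eq) = deleteArc-deleted G u v a

record ArcInjective {N K} (G : Digraph N) (C : Fin N → Fin K) : Set where
  field
    proper : ∀ x y → Arc G x y → C x ≢ C y
    determined : ∀ x y x' y' → Arc G x y → Arc G x' y' → C x ≡ C x' → C y ≡ C y' → x ≡ x' × y ≡ y'

punchOut-cancel : ∀ {n} {i i' j j' : Fin (suc n)} (i≢j : i ≢ j) (i'≢j' : i' ≢ j')
  → i ≡ i' → punchOut i≢j ≡ punchOut i'≢j' → j ≡ j'
punchOut-cancel i≢j i'≢j' refl = punchOut-injective i≢j i'≢j'

arcInjective⇒coding : ∀ {N K} {G : Digraph N} {C : Fin N → Fin (suc K)}
  → ArcInjective G C → ArcCoding G (suc K * K)
arcInjective⇒coding {C = C} inj = record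
  { code = λ x y a → combine (C x) (punchOut (proper x y a))
  ; code-injective = λ x y x' y' a a' eq →
      let Cx≡Cx' , out≡ = combine-injective (C x) _ (C x') _ eq
      in determined x y x' y' a a' Cx≡Cx' (punchOut-cancel (proper x y a) (proper x' y' a') Cx≡Cx' out≡)
  }
  where open ArcInjective inj

arcInjective⇒dac≤ : ∀ {N K r} {G : Digraph N} {C : Fin N → Fin K}
  → ArcInjective G C → HasACC G r → r ≤ K
arcInjective⇒dac≤ {r = zero} _ _ = z≤n
arcInjective⇒dac≤ {K = zero} {suc r} {C = C} _ (_ , surjective , _) with C (proj₁ (surjective zero))
... | ()
arcInjective⇒dac≤ {K = suc K} {suc r} inj (_ , _ , _ , complete) =
  s≤s (pronic-cancel-≤ (complete⇒pronic≤ complete (arcInjective⇒coding inj)))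

arcInjective⇒deleteArc-dac< : ∀ {N K r} {G : Digraph N} {C : Fin N → Fin K} {u v}
  → ArcInjective G C → Arc G u v → HasACC (deleteArc G u v) r → r < K
arcInjective⇒deleteArc-dac< {K = zero} {C = C} {u} _ _ _ with C u
... | ()
arcInjective⇒deleteArc-dac< {K = suc K} {zero} _ _ _ = s≤s z≤n
arcInjective⇒deleteArc-dac< {K = suc K} {suc r} inj uv (_ , _ , _ , complete) =
  s≤s (pronic-cancel-< (complete-deleteArc⇒pronic< complete (arcInjective⇒coding inj) uv))

arcInjective⇒minimal : ∀ {N K} {G : Digraph N} {C : Fin N → Fin K}
  → Surjective C → Acyclic G C → Complete G C → ArcInjective G C → Minimal G K
arcInjective⇒minimal {C = C} surjective acyclic complete inj =
  ((C , surjective , acyclic , complete) , λ _ → arcInjective⇒dac≤ inj) ,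
  λ _ _ uv _ → arcInjective⇒deleteArc-dac< inj uv

deleteArc-complete : ∀ {N K} {G : Digraph N} {c : Fin N → Fin K} {u v} → Complete G c
  → (c u ≢ c v → ∃₂ λ x y → Arc G x y × ¬ (x ≡ u × y ≡ v) × c x ≡ c u × c y ≡ c v)
  → Complete (deleteArc G u v) c
deleteArc-complete {G = G} {u = u} {v} complete replacement i j i≢j with complete i j i≢j
... | x , y , xy , cx , cy with (x ≟ u) ×-dec (y ≟ v)
... | no xy≢uv = x , y , deleteArc-kept G u v xy xy≢uv , cx , cy
... | yes (refl , refl) with replacement (λ cu≡cv → i≢j (trans (sym cx) (trans cu≡cv cy)))
...   | x' , y' , x'y' , x'y'≢uv , cx' , cy' =
  x' , y' , deleteArc-kept G u v x'y' x'y'≢uv , trans cx' cx , trans cy' cy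

module _ {n k} {D : Digraph n} {c : Fin n → Fin k}
  (minimal : Minimal D k) (surjective : Surjective c) (acyclic : Acyclic D c) where

  minimal⇒deleteArc-incomplete : ∀ {u v} → Arc D u v → ¬ Complete (deleteArc D u v) c
  minimal⇒deleteArc-incomplete {u} {v} uv complete =
    <-irrefl refl (proj₂ minimal u v uv k (c , surjective , deleteArc-acyclic D u v {c} acyclic , complete))

  minimal⇒arcInjective : Complete D c → ArcInjective D c
  minimal⇒arcInjective complete = record { proper = proper ; determined = determined }
    where
    proper : ∀ x y → Arc D x y → c x ≢ c y
    proper x y xy cx≡cy =
      minimal⇒deleteArc-incomplete xy (deleteArc-complete complete (contradiction cx≡cy))
    determined : ∀ x y x' y' → Arc D x y → Arc D x' y' → c x ≡ c x' → c y ≡ c y' → x ≡ x' × y ≡ y'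
    determined x y x' y' xy x'y' cx≡ cy≡ with (x ≟ x') ×-dec (y ≟ y')
    ... | yes same = same
    ... | no distinct = contradiction
      (deleteArc-complete complete λ _ →
        x' , y' , x'y' , (λ { (refl , refl) → distinct (refl , refl) }) , sym cx≡ , sym cy≡)
      (minimal⇒deleteArc-incomplete xy)

record ClassFactorization {n k m} (c : Fin n → Fin k) (H : Fin n → Digraph m) : Set where
  field
    loopless : ∀ w a → H w a a ≡ false
    covering : ∀ i a b → a ≢ b → ∃ λ w → c w ≡ i × Arc (H w) a b
    unique : ∀ w w' {a b} → Arc (H w) a b → Arc (H w') a b → c w ≡ c w' → w ≡ w'

relabel⇒classFactorization : ∀ {n k q m} {c : Fin n → Fin k} {H : Fin n → Digraph m}
  (u : Fin k → Fin q → Fin n) → (∀ w → ∃₂ λ i j → u i j ≡ w) → (∀ i j → c (u i j) ≡ i)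
  → (∀ i → RelabelFactorization (λ j → H (u i j))) → ClassFactorization c H
relabel⇒classFactorization {c = c} {H} u u-surjective cu relabel = record
  { loopless = loopless ; covering = covering ; unique = unique }
  where
  loopless : ∀ w a → H w a a ≡ false
  loopless w a with i , j , refl ← u-surjective w = proj₂ (relabel i) j a
  covering : ∀ i a b → a ≢ b → ∃ λ w → c w ≡ i × Arc (H w) a b
  covering i a b a≢b with j , ab , _ ← proj₁ (relabel i) a b a≢b = u i j , cu i j , ab
  unique : ∀ w w' {a b} → Arc (H w) a b → Arc (H w') a b → c w ≡ c w' → w ≡ w'
  unique w w' {a} {b} ab ab' cw≡cw'
    with i , j , refl ← u-surjective w | i' , j' , refl ← u-surjective w'
    with refl ← trans (sym (cu i j)) (trans cw≡cw' (cu i' j'))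
    with a ≟ b
  ... | yes refl = contradiction (trans (sym ab) (loopless (u i j) a)) λ ()
  ... | no a≢b with _ , _ , only ← proj₁ (relabel i) a b a≢b = cong (u i) (trans (only j ab) (sym (only j' ab')))

module Lifted {n k m} (D : Digraph n) (H : Fin n → Digraph m) (c : Fin n → Fin k)
  (factorization : ClassFactorization c H) where
  open ClassFactorization factorization

  base : Fin (n * m) → Fin n
  base p = proj₁ (remQuot {n} m p)

  label : Fin (n * m) → Fin m
  label p = proj₂ (remQuot {n} m p)

  base-label-injective : ∀ {p p'} → base p ≡ base p' → label p ≡ label p' → p ≡ p'
  base-label-injective b≡ l≡ = remQuot-injective {n} m (cong₂ _,_ b≡ l≡)

  Zykov-combine : ∀ w a w' a' → Zykov D H (combine w a) (combine w' a') ≡ zykovAdj D H (w , a) (w' , a')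
  Zykov-combine w a w' a' = cong₂ (zykovAdj D H) (remQuot-combine w a) (remQuot-combine w' a')

  Zykov-arc-inside : ∀ {w a b} → Arc (H w) a b → Arc (Zykov D H) (combine w a) (combine w b)
  Zykov-arc-inside {w} {a} {b} ab = trans (Zykov-combine w a w b) inside
    where
    inside : zykovAdj D H (w , a) (w , b) ≡ true
    inside with w ≟ w
    ... | yes _ = ab
    ... | no w≢w = contradiction refl w≢w

  Zykov-arc-between : ∀ {w w' a a'} → w ≢ w' → Arc D w w' → Arc (Zykov D H) (combine w a) (combine w' a')
  Zykov-arc-between {w} {w'} {a} {a'} w≢w' ww' = trans (Zykov-combine w a w' a') between
    where
    between : zykovAdj D H (w , a) (w' , a') ≡ true
    between with w ≟ w'
    ... | yes w≡w' = contradiction w≡w' w≢w'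
    ... | no _ = ww'

  Zykov-arc⁻ : ∀ {p p'} → Arc (Zykov D H) p p'
    → (base p ≡ base p' × Arc (H (base p)) (label p) (label p'))
    ⊎ (base p ≢ base p' × Arc D (base p) (base p'))
  Zykov-arc⁻ {p} {p'} pp' with base p ≟ base p'
  ... | yes b≡ = inj₁ (b≡ , pp')
  ... | no b≢ = inj₂ (b≢ , pp')

  sameLabel-arc : ∀ {p p'} → Arc (Zykov D H) p p' → label p ≡ label p'
    → base p ≢ base p' × Arc D (base p) (base p')
  sameLabel-arc {p} pp' l≡ with Zykov-arc⁻ pp'
  ... | inj₂ between = between
  ... | inj₁ (_ , loop) =
    contradiction (trans (sym loop) (trans (cong (H (base p) (label p)) (sym l≡)) (loopless (base p) (label p))))
      λ ()

  C : Fin (n * m) → Fin (k * m)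
  C p = combine (c (base p)) (label p)

  C-combine : ∀ w a → C (combine w a) ≡ combine (c w) a
  C-combine w a = cong (λ (w , a) → combine (c w) a) (remQuot-combine w a)

  C-split : ∀ {p p'} → C p ≡ C p' → c (base p) ≡ c (base p') × label p ≡ label p'
  C-split = combine-injective _ _ _ _

  surjective : Surjective c → Surjective C
  surjective c-surjective t with i , a , refl ← combine-surjective {k} {m} t
    with w , refl ← c-surjective i = combine w a , C-combine w a

  acyclic : Acyclic D c → Acyclic (Zykov D H) C
  acyclic c-acyclic l w (w-injective , arcs , closing) monochromatic =
    c-acyclic l (base ∘ w) (base∘w-injective , projectArc ∘ arcs , projectArc closing)
      (proj₁ ∘ C-split ∘ monochromatic)
    where
    sameLabel : ∀ x y → label (w x) ≡ label (w y)
    sameLabel x y = trans (proj₂ (C-split (monochromatic x))) (sym (proj₂ (C-split (monochromatic y))))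
    base∘w-injective : ∀ x y → base (w x) ≡ base (w y) → x ≡ y
    base∘w-injective x y b≡ = w-injective x y (base-label-injective b≡ (sameLabel x y))
    projectArc : ∀ {x y} → Arc (Zykov D H) (w x) (w y) → Arc D (base (w x)) (base (w y))
    projectArc {x} {y} arc = proj₂ (sameLabel-arc arc (sameLabel x y))

  complete : Complete D c → Complete (Zykov D H) C
  complete c-complete t t' t≢t'
    with i , a , refl ← combine-surjective {k} {m} t | i' , a' , refl ← combine-surjective {k} {m} t'
    with i ≟ i'
  ... | no i≢i' with x , y , xy , refl , refl ← c-complete i i' i≢i' =
    combine x a , combine y a' , Zykov-arc-between (i≢i' ∘ cong c) xy , C-combine x a , C-combine y a'
  ... | yes refl with a ≟ a'
  ...   | yes refl = contradiction refl t≢t'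
  ...   | no a≢a' with w , refl , wa ← covering i a a' a≢a' =
    combine w a , combine w a' , Zykov-arc-inside wa , C-combine w a , C-combine w a'

  classSize-combine : ∀ i a → classSize C (combine i a) ≡ classSize c i
  classSize-combine i a = ≤-antisym
    (count-≤-injection (λ p → C p ≟ combine i a) (λ w → c w ≟ i) base
      (λ p → combine-injectiveˡ (c (base p)) (label p) i a)
      (λ p p' Cp≡ Cp'≡ b≡ → base-label-injective b≡ (trans
        (combine-injectiveʳ (c (base p)) (label p) i a Cp≡)
        (sym (combine-injectiveʳ (c (base p')) (label p') i a Cp'≡)))))
    (count-≤-injection (λ w → c w ≟ i) (λ p → C p ≟ combine i a) (λ w → combine w a)
      (λ w cw≡i → trans (C-combine w a) (cong₂ combine cw≡i refl))
      (λ w w' _ _ → combine-injectiveˡ w a w' a))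

  balanced : Balanced c → Balanced C
  balanced c-balanced t t'
    with i , a , refl ← combine-surjective {k} {m} t | i' , a' , refl ← combine-surjective {k} {m} t' =
    trans (classSize-combine i a) (trans (c-balanced i i') (sym (classSize-combine i' a')))

  arcInjective : ArcInjective D c → ArcInjective (Zykov D H) C
  arcInjective c-inj = record { proper = proper ; determined = determined }
    where
    open ArcInjective c-inj renaming (proper to c-proper; determined to c-determined)
    proper : ∀ p p' → Arc (Zykov D H) p p' → C p ≢ C p'
    proper p p' pp' Cp≡Cp' with cb≡ , l≡ ← C-split Cp≡Cp' =
      c-proper _ _ (proj₂ (sameLabel-arc pp' l≡)) cb≡
    -- An arc inside a factor and an arc between factors cannot share their color pair: the first
    -- joins two vertices of the same D-color, the second (by properness of c) does not.
    determined : ∀ p p' r r' → Arc (Zykov D H) p p' → Arc (Zykov D H) r r' → C p ≡ C r → C p' ≡ C r'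
      → p ≡ r × p' ≡ r'
    determined p p' r r' pp' rr' Cp≡ Cp'≡
      with cb≡ , l≡ ← C-split Cp≡ | cb'≡ , l'≡ ← C-split Cp'≡ | Zykov-arc⁻ pp' | Zykov-arc⁻ rr'
    ... | inj₁ (bp≡ , inside) | inj₁ (br≡ , inside') =
      base-label-injective b≡ l≡ , base-label-injective (trans (sym bp≡) (trans b≡ br≡)) l'≡
      where
      b≡ : base p ≡ base r
      b≡ = unique (base p) (base r) inside (subst₂ (Arc (H (base r))) (sym l≡) (sym l'≡) inside') cb≡
    ... | inj₁ (bp≡ , _) | inj₂ (_ , between) =
      contradiction (trans (sym cb≡) (trans (cong c bp≡) cb'≡)) (c-proper _ _ between)
    ... | inj₂ (_ , between) | inj₁ (br≡ , _) =
      contradiction (trans cb≡ (trans (cong c br≡) (sym cb'≡))) (c-proper _ _ between)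
    ... | inj₂ (_ , between) | inj₂ (_ , between')
      with b≡ , b'≡ ← c-determined _ _ _ _ between between' cb≡ cb'≡ =
      base-label-injective b≡ l≡ , base-label-injective b'≡ l'≡

corollary3 : ∀ {n k q m : ℕ} (D : Digraph n) → Loopless D → Minimal D k
    → (c : Fin n → Fin k) → Surjective c → Acyclic D c → Complete D c → Balanced c
    → (u : Fin k → Fin q → Fin n)
    → (∀ i j i' j' → u i j ≡ u i' j' → (i ≡ i' × j ≡ j'))
    → (∀ v → ∃₂ λ i j → u i j ≡ v)
    → (∀ i j → c (u i j) ≡ i)
    → q * k ≡ n
    → 2 ≤ m
    → (H : Fin n → Digraph m)
    → (∀ i → RelabelFactorization (λ j → H (u i j)))
    → Minimal (Zykov D H) (k * m) × HasBalancedACC (Zykov D H) (k * m)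
corollary3 D _ minimal c c-surjective c-acyclic c-complete c-balanced u _ u-surjective cu _ _ H relabel =
  arcInjective⇒minimal C-surjective C-acyclic C-complete (arcInjective c-arcInjective) ,
  C , C-surjective , C-acyclic , C-complete , balanced c-balanced
  where
  open Lifted D H c (relabel⇒classFactorization u u-surjective cu relabel)
  c-arcInjective : ArcInjective D c
  c-arcInjective = minimal⇒arcInjective minimal c-surjective c-acyclic c-complete
  C-surjective : Surjective C
  C-surjective = surjective c-surjective
  C-acyclic : Acyclic (Zykov D H) C
  C-acyclic = acyclic c-acyclic
  C-complete : Complete (Zykov D H) C
  C-complete = complete c-complete
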